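{- Let $G$ be a graph with no isolated vertices and let $uv\in E(G)$ be a TRD-ER-supercritical edge. Then there exists a $\gamma_{tR}(G)$-function $f$ such that $\{f(u),f(v)\}$ is one of the multisets $\{2,2\}$, $\{2,0\}$, $\{1,1\}$.
   Context: All graphs are finite and simple. A total Roman dominating function (TRD-function) on a graph $G$ with no isolated vertices is a function $f:V(G)\to\{0,1,2\}$ such that every vertex $v$ with $f(v)=0$ is adjacent to some $u$ with $f(u)=2$, and the subgraph induced by $\{w:f(w)>0\}$ has no isolated vertices; its weight is $\sum_v f(v)$, $\gamma_{tR}(G)$ is the minimum weight, and a TRD-function of weight $\gamma_{tR}(G)$ is a $\gamma_{tR}(G)$-function. For an edge $e\in E(G)$ incident with a vertex of degree $1$, define $\gamma_{tR}(G-e)=\infty$. An edge $e\in E(G)$ is TRD-ER-supercritical if $\gamma_{tR}(G-e)\geq\gamma_{tR}(G)+2$. -}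

module Defs where

open import Data.Nat using (ℕ; _+_; _≤_; _>_)
open import Data.Fin using (Fin; toℕ; _≟_)
open import Data.Bool using (Bool; true; false; _∧_; not; T)
open import Data.Vec using (tabulate; sum; countᵇ)
open import Data.Product using (_×_; ∃-syntax)
open import Data.Sum using (_⊎_)
open import Relation.Nullary using (¬_; does)
open import Relation.Binary.PropositionalEquality using (_≡_)

record Graph : Set where
  field
    n     : ℕ
    adj   : Fin n → Fin n → Bool
    sym   : ∀ i j → adj i j ≡ adj j i
    irrefl : ∀ i → adj i i ≡ false
open Graph public

Adj : {m : ℕ} → (Fin m → Fin m → Bool) → Fin m → Fin m → Set
Adj A i j = T (A i j)

degree : (G : Graph) → Fin (n G) → ℕ
degree G v = countᵇ (adj G v) (tabulate (λ w → w))

NoIsolated : Graph → Set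
NoIsolated G = ∀ v → ∃[ w ] Adj (adj G) v w

removeEdge : (G : Graph) → Fin (n G) → Fin (n G) → Fin (n G) → Fin (n G) → Bool
removeEdge G u v i j =
  adj G i j ∧ not ((does (i ≟ u) ∧ does (j ≟ v)) Data.Bool.∨ (does (i ≟ v) ∧ does (j ≟ u)))

IsTRDF : {m : ℕ} → (Fin m → Fin m → Bool) → (Fin m → Fin 3) → Set
IsTRDF A f =
  (∀ v → toℕ (f v) ≡ 0 → ∃[ u ] (Adj A v u × toℕ (f u) ≡ 2))
  × (∀ v → toℕ (f v) > 0 → ∃[ w ] (Adj A v w × toℕ (f w) > 0))

weight : {m : ℕ} → (Fin m → Fin 3) → ℕ
weight f = sum (tabulate (λ v → toℕ (f v)))

IsGammaTRF : (G : Graph) → (Fin (n G) → Fin 3) → Set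
IsGammaTRF G f = IsTRDF (adj G) f × (∀ g → IsTRDF (adj G) g → weight f ≤ weight g)

-- uv is TRD-ER-supercritical: γ_tR(G - uv) ≥ γ_tR(G) + 2, where
-- γ_tR(G - uv) = ∞ when u or v has degree 1 in G.
-- Otherwise: every TRD-function of G - uv has weight ≥ γ_tR(G) + 2,
-- with γ_tR(G) the weight of any γ_tR(G)-function.
Supercritical : (G : Graph) → Fin (n G) → Fin (n G) → Set
Supercritical G u v =
  (degree G u ≡ 1 ⊎ degree G v ≡ 1)
  ⊎ (∀ f g → IsGammaTRF G f → IsTRDF (removeEdge G u v) g → weight f + 2 ≤ weight g)

GoodPair : ℕ → ℕ → Set
GoodPair a b =
  (a ≡ 2 × b ≡ 2) ⊎ (a ≡ 2 × b ≡ 0) ⊎ (a ≡ 0 × b ≡ 2) ⊎ (a ≡ 1 × b ≡ 1)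

{-# OPTIONS --safe #-}
-- Fix a γ_tR(G)-function f. Supercriticality says that G − uv has no TRD-function of weight at most
-- w(f) + 1. If the labels of u and v cannot support each other ({0,0} or {0,1}), f itself is a
-- TRD-function of G − uv. This leaves f(u) = 1, f(v) = 2 (up to symmetry). If an endpoint lacking
-- support in G − uv has another neighbour, raising that neighbour from 0 to 1 repairs f at cost 1; if
-- an endpoint is pendant, lowering its label gives a lighter TRD-function of G. In the one remaining
-- configuration neither endpoint has a positive neighbour in G − uv, so some neighbour w ≠ u of v has
-- label 0, and moving the unit of u to w yields a γ_tR(G)-function with labels 0 and 2 on u and v.
module Submission where

open import Defs
open import Data.Fin using (Fin; toℕ)
open import Data.Product using (_×_; ∃-syntax)

open import Data.Bool using (Bool; true; false; T; not; _∧_)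
open import Data.Bool.Properties using (T-∧; T-∨)
open import Data.Empty using (⊥; ⊥-elim)
open import Data.Fin using (zero; suc; _≟_)
open import Data.Fin.Base using (finToFun; funToFin)
open import Data.Fin.Patterns using (0F; 1F; 2F)
open import Data.Fin.Properties using (any?; all?; finToFun-funToFin)
open import Data.Nat using (ℕ; zero; suc; _+_; _≤_; _<_; z≤n; s≤s; _<?_)
open import Data.Nat.Properties
  using (≤-refl; ≤-trans; ≤-reflexive; ≤-pred; <-≤-trans; ≮⇒≥; <⇒≱; m≤m+n; m≤n⇒m≤1+n;
         +-suc; +-assoc; +-comm; +-cancelʳ-≡; +-cancelˡ-≤; suc-injective)
open import Data.Nat.Tactic.RingSolver using (solve-∀)
open import Data.Product using (_,_; proj₁; proj₂; ∃; map₂)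
open import Data.Product.Function.NonDependent.Propositional using (_×-⇔_)
open import Data.Sum using (_⊎_; inj₁; inj₂; [_,_]; swap)
open import Data.Sum.Function.Propositional using (_⊎-⇔_)
open import Data.Vec using (tabulate; countᵇ; sum)
open import Data.Vec.Functional using (updateAt)
open import Data.Vec.Functional.Properties using (updateAt-updates; updateAt-minimal)
open import Data.Vec.Properties using (tabulate-cong)
open import Function using (_∘_; const; _⇔_; mk⇔; Equivalence)
open import Function.Construct.Composition using (_⇔-∘_)
open import Function.Construct.Identity using (⇔-id)
open import Function.Related.TypeIsomorphisms using (¬-cong-⇔)
open import Relation.Binary.PropositionalEquality as ≡
  using (_≡_; _≢_; refl; trans; cong; subst; subst₂; _≗_; ≢-sym)
open import Relation.Nullary using (¬_; Dec; yes; no; does; map′)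
open import Relation.Nullary.Decidable using (_×-dec_; T?; ¬?; decidable-stable)

variable
  m : ℕ
  A B : Fin m → Fin m → Bool
  f g : Fin m → Fin 3
  a b : Fin 3
  p u v w x y : Fin m

≡suc⇒≢0 : ∀ {c : Fin 2} → a ≡ suc c → a ≢ 0F
≡suc⇒≢0 refl ()

-- Merges the two clauses of IsTRDF: a vertex labelled a is satisfied by a neighbour labelled b.
data Supports : Fin 3 → Fin 3 → Set where
  two-supports-zero : Supports 0F 2F
  pos-supports-pos  : ∀ {a b} → Supports (suc a) (suc b)

Supports? : ∀ a b → Dec (Supports a b)
Supports? 0F      0F      = no λ ()
Supports? 0F      1F      = no λ ()
Supports? 0F      2F      = yes two-supports-zero
Supports? (suc a) 0F      = no λ ()
Supports? (suc a) (suc b) = yes pos-supports-pos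

¬Supports-at : ∀ {c d} → c ≡ a → d ≡ b → ¬ Supports a b → ¬ Supports c d
¬Supports-at c≡a d≡b ¬ab = ¬ab ∘ subst₂ Supports c≡a d≡b

Supports-positive : Supports a b → a ≢ 0F → b ≢ 0F
Supports-positive two-supports-zero a≢0 = ⊥-elim (a≢0 refl)
Supports-positive pos-supports-pos  _   ()

positive-supports : a ≢ 0F → b ≢ 0F → Supports a b
positive-supports {0F}              a≢0 _   = ⊥-elim (a≢0 refl)
positive-supports {suc _} {0F}      _   b≢0 = ⊥-elim (b≢0 refl)
positive-supports {suc _} {suc _}   _   _   = pos-supports-pos

record Supported (A : Fin m → Fin m → Bool) (f : Fin m → Fin 3) (x : Fin m) : Set where
  constructor supported-by
  field
    neighbour : Fin m
    adjacent  : Adj A x neighbour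
    supports  : Supports (f x) (f neighbour)

TotalRoman : (Fin m → Fin m → Bool) → (Fin m → Fin 3) → Set
TotalRoman A f = ∀ x → Supported A f x

IsMinimumTR : (Fin m → Fin m → Bool) → (Fin m → Fin 3) → Set
IsMinimumTR A f = TotalRoman A f × (∀ g → TotalRoman A g → weight f ≤ weight g)

supported-via : Adj A x y → Supports a b → f x ≡ a → f y ≡ b → Supported A f x
supported-via {y = y} xy s fx fy = supported-by y xy (subst₂ Supports (≡.sym fx) (≡.sym fy) s)

Supported? : (A : Fin m → Fin m → Bool) (f : Fin m → Fin 3) (x : Fin m) → Dec (Supported A f x)
Supported? A f x =
  map′ (λ (y , xy , s) → supported-by y xy s) (λ (supported-by y xy s) → y , xy , s)
       (any? λ y → T? (A x y) ×-dec Supports? (f x) (f y))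

TotalRoman? : (A : Fin m → Fin m → Bool) (f : Fin m → Fin 3) → Dec (TotalRoman A f)
TotalRoman? A f = all? (Supported? A f)

TotalRoman-cong : f ≗ g → TotalRoman A f → TotalRoman A g
TotalRoman-cong f≗g tr x =
  let supported-by y xy s = tr x in supported-via xy s (≡.sym (f≗g x)) (≡.sym (f≗g y))

IsTRDF⇔TotalRoman : IsTRDF A f ⇔ TotalRoman A f
IsTRDF⇔TotalRoman {f = f} = mk⇔ to from
  where
  to : IsTRDF A f → TotalRoman A f
  to (needs-two , needs-pos) x with f x in fx
  ... | 0F = let y , xy , fy≡2 = needs-two x (cong toℕ fx) in supported-via xy (two fy≡2) fx refl
    where
    two : toℕ b ≡ 2 → Supports 0F b
    two {2F} refl = two-supports-zero
  ... | suc _ = let y , xy , fy>0 = needs-pos x (≤-trans (s≤s z≤n) (≤-reflexive (≡.sym (cong toℕ fx))))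
                in supported-via xy (pos fy>0) fx refl
    where
    pos : ∀ {c : Fin 2} → 0 < toℕ b → Supports (suc c) b
    pos {suc _} _ = pos-supports-pos

  from : TotalRoman A f → IsTRDF A f
  from tr = (λ x fx≡0 → let supported-by y xy s = tr x in y , xy , two s fx≡0)
          , (λ x fx>0 → let supported-by y xy s = tr x in y , xy , pos s fx>0)
    where
    two : Supports a b → toℕ a ≡ 0 → toℕ b ≡ 2
    two two-supports-zero _ = refl
    pos : Supports a b → 0 < toℕ a → 0 < toℕ b
    pos pos-supports-pos _ = s≤s z≤n

IsMinimumTR⇒IsGammaTRF : (G : Graph) {f : Fin (n G) → Fin 3} → IsMinimumTR (adj G) f → IsGammaTRF G f
IsMinimumTR⇒IsGammaTRF G (f-TR , f-min) =
  Equivalence.from IsTRDF⇔TotalRoman f-TR , λ g g-TRDF → f-min g (Equivalence.to IsTRDF⇔TotalRoman g-TRDF)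

IsMinimumTR-≡weight : IsMinimumTR A f → TotalRoman A g → weight g ≡ weight f → IsMinimumTR A g
IsMinimumTR-≡weight (_ , f-min) g-TR g≡f = g-TR , λ h h-TR → ≤-trans (≤-reflexive g≡f) (f-min h h-TR)

lighter-absurd : IsMinimumTR A f → TotalRoman A g → weight g < weight f → ⊥
lighter-absurd (_ , f-min) g-TR g<f = <⇒≱ g<f (f-min _ g-TR)

infixl 6 _[_]≔_
_[_]≔_ : (Fin m → Fin 3) → Fin m → Fin 3 → Fin m → Fin 3
f [ w ]≔ a = updateAt f w (const a)

[]≔-updates : ∀ (f : Fin m → Fin 3) w a → (f [ w ]≔ a) w ≡ a
[]≔-updates f w a = updateAt-updates w f

[]≔-minimal : x ≢ w → (f [ w ]≔ a) x ≡ f x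
[]≔-minimal {x = x} {w = w} {f = f} x≢w = updateAt-minimal x w f x≢w

Supported-[]≔ : x ≢ w → (Adj A x w → Supports (f x) (f w) → Supports (f x) a) →
  Supported A f x → Supported A (f [ w ]≔ a) x
Supported-[]≔ {x = x} {w = w} {f = f} {a = a} x≢w replace (supported-by y xy s) with y ≟ w
... | yes refl = supported-via xy (replace xy s) ([]≔-minimal x≢w) ([]≔-updates f y a)
... | no y≢w   = supported-via xy s ([]≔-minimal x≢w) ([]≔-minimal y≢w)

weight-[]≔ : ∀ (f : Fin m → Fin 3) w a → weight (f [ w ]≔ a) + toℕ (f w) ≡ weight f + toℕ a
weight-[]≔ f zero a = swap-ends (toℕ a) (weight (f ∘ suc)) (toℕ (f zero))
  where
  swap-ends : ∀ a s b → a + s + b ≡ b + s + a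
  swap-ends = solve-∀
weight-[]≔ f (suc w) a = begin
  f₀ + weight ((f ∘ suc) [ w ]≔ a) + toℕ (f (suc w))    ≡⟨ +-assoc f₀ _ _ ⟩
  f₀ + (weight ((f ∘ suc) [ w ]≔ a) + toℕ (f (suc w)))  ≡⟨ cong (f₀ +_) (weight-[]≔ (f ∘ suc) w a) ⟩
  f₀ + (weight (f ∘ suc) + toℕ a)                       ≡⟨ +-assoc f₀ _ _ ⟨
  f₀ + weight (f ∘ suc) + toℕ a                         ∎
  where
  open ≡.≡-Reasoning
  f₀ : ℕ
  f₀ = toℕ (f zero)

weight-[]≔-pred : ∀ (f : Fin m → Fin 3) w → toℕ (f w) ≡ suc (toℕ a) →
  suc (weight (f [ w ]≔ a)) ≡ weight f
weight-[]≔-pred {a = a} f w fw = +-cancelʳ-≡ (toℕ a) _ _ (begin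
  suc (weight (f [ w ]≔ a)) + toℕ a  ≡⟨ +-suc (weight (f [ w ]≔ a)) (toℕ a) ⟨
  weight (f [ w ]≔ a) + suc (toℕ a)  ≡⟨ cong (weight (f [ w ]≔ a) +_) fw ⟨
  weight (f [ w ]≔ a) + toℕ (f w)    ≡⟨ weight-[]≔ f w a ⟩
  weight f + toℕ a                   ∎)
  where open ≡.≡-Reasoning

weight-[]≔-suc : ∀ (f : Fin m → Fin 3) w → toℕ a ≡ suc (toℕ (f w)) →
  weight (f [ w ]≔ a) ≡ suc (weight f)
weight-[]≔-suc {a = a} f w fw = +-cancelʳ-≡ (toℕ (f w)) _ _ (begin
  weight (f [ w ]≔ a) + toℕ (f w)  ≡⟨ weight-[]≔ f w a ⟩
  weight f + toℕ a                 ≡⟨ cong (weight f +_) fw ⟩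
  weight f + suc (toℕ (f w))       ≡⟨ +-suc (weight f) (toℕ (f w)) ⟩
  suc (weight f) + toℕ (f w)       ∎)
  where open ≡.≡-Reasoning

weight-cong : f ≗ g → weight f ≡ weight g
weight-cong f≗g = cong sum (tabulate-cong (cong toℕ ∘ f≗g))

-- Functions Fin m → Fin k are enumerated by Fin (k ^ m).
any-function? : ∀ {k} {P : (Fin m → Fin k) → Set} → (∀ {f g} → f ≗ g → P f → P g) →
  (∀ f → Dec (P f)) → Dec (∃ P)
any-function? P-cong P? =
  map′ (λ (i , Pi) → finToFun i , Pi)
       (λ (f , Pf) → funToFin f , P-cong (≡.sym ∘ finToFun-funToFin f) Pf)
       (any? (P? ∘ finToFun))

module _ {P : (Fin m → Fin 3) → Set} (P-cong : ∀ {f g} → f ≗ g → P f → P g) (P? : ∀ f → Dec (P f)) where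

  minimum-weight : ∀ k → P f → weight f ≤ k → ∃[ g ] (P g × ∀ h → P h → weight g ≤ weight h)
  minimum-weight {f = f} zero Pf f≤0 = f , Pf , λ _ _ → ≤-trans f≤0 z≤n
  minimum-weight {f = f} (suc k) Pf f≤k
    with any-function? (λ f≗g (Pf , f<) → P-cong f≗g Pf , subst (_< weight f) (weight-cong f≗g) f<)
                       (λ h → P? h ×-dec (weight h <? weight f))
  ... | yes (h , Ph , h<f) = minimum-weight k Ph (≤-pred (<-≤-trans h<f f≤k))
  ... | no no-lighter      = f , Pf , λ h Ph → ≮⇒≥ λ h<f → no-lighter (h , Ph , h<f)

IsMinimumTR-exists : (G : Graph) → NoIsolated G → ∃ (IsMinimumTR (adj G))
IsMinimumTR-exists G no-isolated = minimum-weight TotalRoman-cong (TotalRoman? (adj G)) _ all-one ≤-refl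
  where
  all-one : TotalRoman (adj G) (const 1F)
  all-one x = let y , xy = no-isolated x in supported-by y xy pos-supports-pos

adj-sym : (G : Graph) {x y : Fin (n G)} → Adj (adj G) x y → Adj (adj G) y x
adj-sym G {x} {y} = subst T (Graph.sym G x y)

adj-irrefl : (G : Graph) {x y : Fin (n G)} → Adj (adj G) x y → x ≢ y
adj-irrefl G {x} xy refl = subst T (Graph.irrefl G x) xy

other-neighbour? : (A : Fin m → Fin m → Bool) (x y : Fin m) →
  ∃[ w ] (Adj A x w × w ≢ y) ⊎ (∀ w → Adj A x w → w ≡ y)
other-neighbour? A x y with any? (λ w → T? (A x w) ×-dec ¬? (w ≟ y))
... | yes found = inj₁ found
... | no none   = inj₂ λ w xw → decidable-stable (w ≟ y) (λ w≢y → none (w , xw , w≢y))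

-- p need not be satisfied under f: after the raise, w and p satisfy each other.
raise-zero : f w ≡ 0F → Adj A w p → Adj A p w → f p ≢ 0F →
  (∀ x → x ≢ w → x ≢ p → Supported A f x) → TotalRoman A (f [ w ]≔ 1F)
raise-zero {f = f} {w = w} {p = p} fw≡0 wp pw fp≢0 others x with x ≟ w | x ≟ p
... | yes refl | _ =
  supported-via wp (positive-supports (λ ()) fp≢0) ([]≔-updates f x 1F) ([]≔-minimal p≢w)
  where
  p≢w : p ≢ x
  p≢w p≡w = fp≢0 (trans (cong f p≡w) fw≡0)
... | no x≢w | yes refl =
  supported-via pw (positive-supports fp≢0 (λ ())) ([]≔-minimal x≢w) ([]≔-updates f w 1F)
... | no x≢w | no x≢p =
  Supported-[]≔ x≢w (λ _ → ⊥-elim ∘ ¬Supports-at refl fw≡0 λ ()) (others x x≢w x≢p)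

-- No vertex of label 0 relies on v when all neighbours of v are positive.
demote-two : (G : Graph) {f : Fin (n G) → Fin 3} {v : Fin (n G)} → TotalRoman (adj G) f → f v ≡ 2F →
  (∀ x → Adj (adj G) x v → f x ≢ 0F) → TotalRoman (adj G) (f [ v ]≔ 1F)
demote-two G {f} {v} f-TR fv≡2 neighbours-positive x with x ≟ v
... | yes refl = let supported-by y xy s = f-TR x
                     fy≢0 = Supports-positive s (≡suc⇒≢0 fv≡2)
                 in supported-via xy (positive-supports (λ ()) fy≢0)
                      ([]≔-updates f x 1F) ([]≔-minimal (≢-sym (adj-irrefl G xy)))
... | no x≢v = Supported-[]≔ x≢v (λ xv _ → positive-supports (neighbours-positive x xv) (λ ())) (f-TR x)

-- Nobody relies on the label-1 vertex u for a 2, so u may drop to 0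
-- once its positive neighbours have other support.
demote-one : TotalRoman A f → f u ≡ 1F → Adj A u v → f v ≡ 2F →
  (∀ x → Adj A x u → f x ≢ 0F → ∃[ y ] (Adj A x y × y ≢ u × f y ≢ 0F)) →
  TotalRoman A (f [ u ]≔ 0F)
demote-one {A = A} {f = f} {u = u} {v = v} f-TR fu≡1 uv fv≡2 backup x with x ≟ u
... | yes refl = supported-via uv two-supports-zero ([]≔-updates f x 0F) (trans ([]≔-minimal v≢u) fv≡2)
  where
  v≢u : v ≢ x
  v≢u v≡u with trans (≡.sym fv≡2) (trans (cong f v≡u) fu≡1)
  ... | ()
... | no x≢u with T? (A x u)
...   | no ¬xu = Supported-[]≔ x≢u (λ xu → ⊥-elim (¬xu xu)) (f-TR x)
...   | yes xu with f x ≟ 0F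
...     | yes fx≡0 = Supported-[]≔ x≢u (λ _ → ⊥-elim ∘ ¬Supports-at fx≡0 fu≡1 λ ()) (f-TR x)
...     | no fx≢0 = let y , xy , y≢u , fy≢0 = backup x xu fx≢0
                    in supported-via xy (positive-supports fx≢0 fy≢0) ([]≔-minimal x≢u) ([]≔-minimal y≢u)

repair-at-positive : f p ≢ 0F → Adj B p w → Adj B w p → (∀ x → x ≢ p → Supported B f x) →
  ∃[ g ] (TotalRoman B g × weight g ≤ weight f + 1)
repair-at-positive {f = f} {p = p} {B = B} {w = w} fp≢0 pw wp others with Supported? B f p
... | yes p-ok = f , all-supported , m≤m+n (weight f) 1
  where
  all-supported : TotalRoman B f
  all-supported x with x ≟ p
  ... | yes refl = p-ok
  ... | no x≢p   = others x x≢p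
... | no p-bad = f [ w ]≔ 1F , raise-zero fw≡0 wp pw fp≢0 (λ x _ → others x)
               , ≤-reflexive (trans (weight-[]≔-suc f w (cong (suc ∘ toℕ) (≡.sym fw≡0))) (+-comm 1 (weight f)))
  where
  fw≡0 : f w ≡ 0F
  fw≡0 = decidable-stable (f w ≟ 0F) (λ fw≢0 → p-bad (supported-by w pw (positive-supports fp≢0 fw≢0)))

SameEdge : Fin m → Fin m → Fin m → Fin m → Set
SameEdge u v x y = (x ≡ u × y ≡ v) ⊎ (x ≡ v × y ≡ u)

IsEdgeDeletion : (A B : Fin m → Fin m → Bool) → Fin m → Fin m → Set
IsEdgeDeletion A B u v = ∀ x y → Adj B x y ⇔ (Adj A x y × ¬ SameEdge u v x y)

T-does : ∀ {P : Set} (P? : Dec P) → T (does P?) ⇔ P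
T-does (yes p) = mk⇔ (const p) (const _)
T-does (no ¬p) = mk⇔ (λ ()) ¬p

T-not : ∀ {b} → T (not b) ⇔ (¬ T b)
T-not {true}  = mk⇔ (λ ()) (λ ¬t → ¬t _)
T-not {false} = mk⇔ (λ _ ()) (const _)

removeEdge-deletes : (G : Graph) (u v : Fin (n G)) → IsEdgeDeletion (adj G) (removeEdge G u v) u v
removeEdge-deletes G u v x y =
  (⇔-id _ ×-⇔ (¬-cong-⇔ (same-edge ⇔-∘ T-∨) ⇔-∘ T-not)) ⇔-∘ T-∧
  where
  same-edge : (T (does (x ≟ u) ∧ does (y ≟ v)) ⊎ T (does (x ≟ v) ∧ does (y ≟ u))) ⇔ SameEdge u v x y
  same-edge =   ((T-does (x ≟ u) ×-⇔ T-does (y ≟ v)) ⇔-∘ T-∧)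
            ⊎-⇔ ((T-does (x ≟ v) ×-⇔ T-does (y ≟ u)) ⇔-∘ T-∧)

SameEdge-endpoint : SameEdge u v u w → w ≡ v
SameEdge-endpoint (inj₁ (_ , w≡v))   = w≡v
SameEdge-endpoint (inj₂ (u≡v , w≡u)) = trans w≡u u≡v

module _ (del : IsEdgeDeletion A B u v) where

  IsEdgeDeletion-swap : IsEdgeDeletion A B v u
  IsEdgeDeletion-swap x y = (⇔-id _ ×-⇔ ¬-cong-⇔ (mk⇔ swap swap)) ⇔-∘ del x y

  deletion-⊆ : Adj B x y → Adj A x y
  deletion-⊆ {x} {y} = proj₁ ∘ Equivalence.to (del x y)

  deletion-removes : ¬ Adj B u v
  deletion-removes uv = proj₂ (Equivalence.to (del u v) uv) (inj₁ (refl , refl))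

  deletion-keeps : Adj A u w → w ≢ v → Adj B u w
  deletion-keeps {w} uw w≢v = Equivalence.from (del u w) (uw , w≢v ∘ SameEdge-endpoint)

  deletion-sym : (∀ {x y} → Adj A x y → Adj A y x) → Adj B x y → Adj B y x
  deletion-sym {x} {y} A-sym xy =
    let A-xy , different = Equivalence.to (del x y) xy
    in Equivalence.from (del y x) (A-sym A-xy , different ∘ flip)
    where
    flip : SameEdge u v y x → SameEdge u v x y
    flip (inj₁ (y≡u , x≡v)) = inj₂ (x≡v , y≡u)
    flip (inj₂ (y≡v , x≡u)) = inj₁ (x≡u , y≡v)

  Supported-deleteEdge : (∀ y → SameEdge u v x y → ¬ Supports (f x) (f y)) →
    Supported A f x → Supported B f x
  Supported-deleteEdge {x} unneeded (supported-by y xy s) =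
    supported-by y (Equivalence.from (del x y) (xy , λ same → unneeded y same s)) s

  Supported-deleteEdge-end : ¬ Supports (f u) (f v) → Supported A f u → Supported B f u
  Supported-deleteEdge-end {f} ¬uv =
    Supported-deleteEdge λ y same → ¬uv ∘ subst (Supports (f u) ∘ f) (SameEdge-endpoint same)

  Supported-deleteEdge-inner : x ≢ u → x ≢ v → Supported A f x → Supported B f x
  Supported-deleteEdge-inner x≢u x≢v =
    Supported-deleteEdge λ _ same _ → [ x≢u ∘ proj₁ , x≢v ∘ proj₁ ] same

  pendant-edge-isolates : (∀ y → Adj A u y → y ≡ v) → ¬ TotalRoman B g
  pendant-edge-isolates pendant g-TR =
    let supported-by y uy _ = g-TR u
    in deletion-removes (subst (Adj B u) (pendant y (deletion-⊆ uy)) uy)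

1≤countᵇ-tabulate : ∀ {X : Set} {k} (P : X → Bool) (h : Fin k → X) i →
  T (P (h i)) → 1 ≤ countᵇ P (tabulate h)
1≤countᵇ-tabulate P h zero Phi with P (h zero) | Phi
... | true | _ = s≤s z≤n
1≤countᵇ-tabulate P h (suc i) Phi with P (h zero)
... | true  = s≤s z≤n
... | false = 1≤countᵇ-tabulate P (h ∘ suc) i Phi

2≤countᵇ-tabulate : ∀ {X : Set} {k} (P : X → Bool) (h : Fin k → X) i j → i ≢ j →
  T (P (h i)) → T (P (h j)) → 2 ≤ countᵇ P (tabulate h)
2≤countᵇ-tabulate P h zero zero 0≢0 _ _ = ⊥-elim (0≢0 refl)
2≤countᵇ-tabulate P h zero (suc j) _ Phi Phj with P (h zero) | Phi
... | true | _ = s≤s (1≤countᵇ-tabulate P (h ∘ suc) j Phj)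
2≤countᵇ-tabulate P h (suc i) zero _ Phi Phj with P (h zero) | Phj
... | true | _ = s≤s (1≤countᵇ-tabulate P (h ∘ suc) i Phi)
2≤countᵇ-tabulate P h (suc i) (suc j) i≢j Phi Phj with P (h zero)
... | true  = m≤n⇒m≤1+n (2≤countᵇ-tabulate P (h ∘ suc) i j (i≢j ∘ cong suc) Phi Phj)
... | false = 2≤countᵇ-tabulate P (h ∘ suc) i j (i≢j ∘ cong suc) Phi Phj

degree-one-pendant : (G : Graph) {u v : Fin (n G)} → degree G u ≡ 1 → Adj (adj G) u v →
  ∀ y → Adj (adj G) u y → y ≡ v
degree-one-pendant G {u} {v} deg≡1 uv y uy with y ≟ v
... | yes y≡v = y≡v
... | no y≢v with subst (2 ≤_) deg≡1 (2≤countᵇ-tabulate (adj G u) (λ z → z) y v y≢v uy uv)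
...   | s≤s ()

module _ (G : Graph) {B : Fin (n G) → Fin (n G) → Bool} {u v : Fin (n G)}
         (del : IsEdgeDeletion (adj G) B u v) (uv : Adj (adj G) u v)
         {f : Fin (n G) → Fin 3} (f-min : IsMinimumTR (adj G) f)
         (B-heavy : ∀ g → TotalRoman B g → weight f + 2 ≤ weight g) where

  private
    f-TR : TotalRoman (adj G) f
    f-TR = proj₁ f-min

  cheap-absurd : TotalRoman B g → weight g ≤ weight f + 1 → ⊥
  cheap-absurd g-TR g≤ with +-cancelˡ-≤ (weight f) 2 1 (≤-trans (B-heavy _ g-TR) g≤)
  ... | s≤s ()

  repair-absurd : f p ≢ 0F → Adj B p w → (∀ x → x ≢ p → Supported B f x) → ⊥
  repair-absurd fp≢0 pw others =
    let g , g-TR , g≤ = repair-at-positive fp≢0 pw (deletion-sym del (adj-sym G) pw) others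
    in cheap-absurd g-TR g≤

  f-supported-except-u : Supported B f v → ∀ x → x ≢ u → Supported B f x
  f-supported-except-u v-ok x x≢u with x ≟ v
  ... | yes refl = v-ok
  ... | no x≢v   = Supported-deleteEdge-inner del x≢u x≢v (f-TR x)

  f-supported-except-v : Supported B f u → ∀ x → x ≢ v → Supported B f x
  f-supported-except-v u-ok x x≢v with x ≟ u
  ... | yes refl = u-ok
  ... | no x≢u   = Supported-deleteEdge-inner del x≢u x≢v (f-TR x)

  ends-unsupported-absurd : f u ≡ a → f v ≡ b → ¬ Supports a b → ¬ Supports b a → ⊥
  ends-unsupported-absurd fu fv ¬ab ¬ba = cheap-absurd f-TR-in-B (m≤m+n (weight f) 1)
    where
    ¬uv : ¬ Supports (f u) (f v)
    ¬uv = ¬Supports-at fu fv ¬ab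
    ¬vu : ¬ Supports (f v) (f u)
    ¬vu = ¬Supports-at fv fu ¬ba
    f-TR-in-B : TotalRoman B f
    f-TR-in-B x with x ≟ v
    ... | yes refl = Supported-deleteEdge-end (IsEdgeDeletion-swap del) ¬vu (f-TR x)
    ... | no x≢v   = f-supported-except-v (Supported-deleteEdge-end del ¬uv (f-TR u)) x x≢v

  module _ (fu≡1 : f u ≡ 1F) (fv≡2 : f v ≡ 2F) where

    private
      fu≢0 : f u ≢ 0F
      fu≢0 = ≡suc⇒≢0 fu≡1
      fv≢0 : f v ≢ 0F
      fv≢0 = ≡suc⇒≢0 fv≡2

    v-pendant-absurd : (∀ y → Adj (adj G) v y → y ≡ u) → ⊥
    v-pendant-absurd pendant =
      lighter-absurd f-min (demote-two G f-TR fv≡2 neighbours-positive)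
                     (≤-reflexive (weight-[]≔-pred f v (cong toℕ fv≡2)))
      where
      neighbours-positive : ∀ x → Adj (adj G) x v → f x ≢ 0F
      neighbours-positive x xv = subst (λ y → f y ≢ 0F) (≡.sym (pendant x (adj-sym G xv))) fu≢0

    u-pendant-absurd : (∀ y → Adj (adj G) u y → y ≡ v) → Supported B f v → ⊥
    u-pendant-absurd pendant (supported-by y vy s) =
      lighter-absurd f-min (demote-one f-TR fu≡1 uv fv≡2 backup)
                     (≤-reflexive (weight-[]≔-pred f u (cong toℕ fu≡1)))
      where
      backup : ∀ x → Adj (adj G) x u → f x ≢ 0F → ∃[ z ] (Adj (adj G) x z × z ≢ u × f z ≢ 0F)
      backup x xu _ with pendant x (adj-sym G xu)
      ... | refl = y , deletion-⊆ del vy , (λ { refl → deletion-removes (IsEdgeDeletion-swap del) vy })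
                 , Supports-positive s fv≢0

    exchange : Adj (adj G) v w → w ≢ u → ¬ Supported B f u → ¬ Supported B f v →
      ∃[ g ] (IsMinimumTR (adj G) g × GoodPair (toℕ (g u)) (toℕ (g v)))
    exchange {w} vw w≢u u-bad v-bad =
      f₂ , IsMinimumTR-≡weight f-min f₂-TR same-weight
         , inj₂ (inj₂ (inj₁ (cong toℕ f₂u≡0 , cong toℕ f₂v≡2)))
      where
      fw≡0 : f w ≡ 0F
      fw≡0 = decidable-stable (f w ≟ 0F) λ fw≢0 →
        v-bad (supported-by w (deletion-keeps (IsEdgeDeletion-swap del) vw w≢u)
                              (positive-supports fv≢0 fw≢0))
      v≢u : v ≢ u
      v≢u = ≢-sym (adj-irrefl G uv)
      f₁ : Fin (n G) → Fin 3
      f₁ = f [ w ]≔ 1F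
      f₁-TR : TotalRoman (adj G) f₁
      f₁-TR = raise-zero fw≡0 (adj-sym G vw) vw fv≢0 (λ x _ _ → f-TR x)
      f₁u≡1 : f₁ u ≡ 1F
      f₁u≡1 = trans ([]≔-minimal (≢-sym w≢u)) fu≡1
      f₁v≡2 : f₁ v ≡ 2F
      f₁v≡2 = trans ([]≔-minimal (adj-irrefl G vw)) fv≡2
      backup : ∀ x → Adj (adj G) x u → f₁ x ≢ 0F → ∃[ y ] (Adj (adj G) x y × y ≢ u × f₁ y ≢ 0F)
      backup x xu f₁x≢0 with x ≟ v | x ≟ w
      ... | yes refl | _      = w , vw , w≢u , ≡suc⇒≢0 ([]≔-updates f w 1F)
      ... | no _     | yes refl = v , adj-sym G vw , v≢u , ≡suc⇒≢0 f₁v≡2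
      ... | no x≢v   | no x≢w =
        ⊥-elim (u-bad (supported-by x (deletion-keeps del (adj-sym G xu) x≢v)
                                      (positive-supports fu≢0 (subst (_≢ 0F) ([]≔-minimal x≢w) f₁x≢0))))
      f₂ : Fin (n G) → Fin 3
      f₂ = f₁ [ u ]≔ 0F
      f₂-TR : TotalRoman (adj G) f₂
      f₂-TR = demote-one f₁-TR f₁u≡1 uv f₁v≡2 backup
      same-weight : weight f₂ ≡ weight f
      same-weight = suc-injective (trans (weight-[]≔-pred f₁ u (cong toℕ f₁u≡1))
                                         (weight-[]≔-suc f w (cong (suc ∘ toℕ) (≡.sym fw≡0))))
      f₂u≡0 : f₂ u ≡ 0F
      f₂u≡0 = []≔-updates f₁ u 0F
      f₂v≡2 : f₂ v ≡ 2F
      f₂v≡2 = trans ([]≔-minimal v≢u) f₁v≡2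

    one-two-case : ∃[ g ] (IsMinimumTR (adj G) g × GoodPair (toℕ (g u)) (toℕ (g v)))
    one-two-case with other-neighbour? (adj G) v u
    ... | inj₂ v-pendant = ⊥-elim (v-pendant-absurd v-pendant)
    ... | inj₁ (w , vw , w≢u) with Supported? B f u
    ...   | yes u-ok =
      ⊥-elim (repair-absurd fv≢0 (deletion-keeps (IsEdgeDeletion-swap del) vw w≢u)
                                 (f-supported-except-v u-ok))
    ...   | no u-bad with Supported? B f v
    ...     | no v-bad = exchange vw w≢u u-bad v-bad
    ...     | yes v-ok with other-neighbour? (adj G) u v
    ...       | inj₂ u-pendant = ⊥-elim (u-pendant-absurd u-pendant v-ok)
    ...       | inj₁ (w′ , uw′ , w′≢v) =
      ⊥-elim (repair-absurd fu≢0 (deletion-keeps del uw′ w′≢v) (f-supported-except-u v-ok))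

GoodPair-sym : ∀ {i j} → GoodPair i j → GoodPair j i
GoodPair-sym (inj₁ (i≡2 , j≡2))               = inj₁ (j≡2 , i≡2)
GoodPair-sym (inj₂ (inj₁ (i≡2 , j≡0)))        = inj₂ (inj₂ (inj₁ (j≡0 , i≡2)))
GoodPair-sym (inj₂ (inj₂ (inj₁ (i≡0 , j≡2)))) = inj₂ (inj₁ (j≡2 , i≡0))
GoodPair-sym (inj₂ (inj₂ (inj₂ (i≡1 , j≡1)))) = inj₂ (inj₂ (inj₂ (j≡1 , i≡1)))

minimum-with-GoodPair : (G : Graph) {B : Fin (n G) → Fin (n G) → Bool} {u v : Fin (n G)}
  {f : Fin (n G) → Fin 3} →
  IsEdgeDeletion (adj G) B u v → Adj (adj G) u v → IsMinimumTR (adj G) f →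
  (∀ g → TotalRoman B g → weight f + 2 ≤ weight g) →
  ∃[ g ] (IsMinimumTR (adj G) g × GoodPair (toℕ (g u)) (toℕ (g v)))
minimum-with-GoodPair G {u = u} {v} {f} del uv f-min B-heavy with f u in fu | f v in fv
... | 0F | 0F = ⊥-elim (ends-unsupported-absurd G del uv f-min B-heavy fu fv (λ ()) (λ ()))
... | 0F | 1F = ⊥-elim (ends-unsupported-absurd G del uv f-min B-heavy fu fv (λ ()) (λ ()))
... | 1F | 0F = ⊥-elim (ends-unsupported-absurd G del uv f-min B-heavy fu fv (λ ()) (λ ()))
... | 0F | 2F = f , f-min , inj₂ (inj₂ (inj₁ (cong toℕ fu , cong toℕ fv)))
... | 2F | 0F = f , f-min , inj₂ (inj₁ (cong toℕ fu , cong toℕ fv))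
... | 1F | 1F = f , f-min , inj₂ (inj₂ (inj₂ (cong toℕ fu , cong toℕ fv)))
... | 2F | 2F = f , f-min , inj₁ (cong toℕ fu , cong toℕ fv)
... | 1F | 2F = one-two-case G del uv f-min B-heavy fu fv
... | 2F | 1F =
  map₂ (map₂ GoodPair-sym) (one-two-case G (IsEdgeDeletion-swap del) (adj-sym G uv) f-min B-heavy fv fu)

supercritical-heavy : (G : Graph) {u v : Fin (n G)} {f : Fin (n G) → Fin 3} → Adj (adj G) u v →
  Supercritical G u v → IsMinimumTR (adj G) f →
  ∀ g → TotalRoman (removeEdge G u v) g → weight f + 2 ≤ weight g
supercritical-heavy G {u} {v} uv (inj₁ (inj₁ deg-u≡1)) _ g g-TR =
  ⊥-elim (pendant-edge-isolates (removeEdge-deletes G u v) (degree-one-pendant G deg-u≡1 uv) g-TR)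
supercritical-heavy G {u} {v} uv (inj₁ (inj₂ deg-v≡1)) _ g g-TR =
  ⊥-elim (pendant-edge-isolates (IsEdgeDeletion-swap (removeEdge-deletes G u v))
                                (degree-one-pendant G deg-v≡1 (adj-sym G uv)) g-TR)
supercritical-heavy G uv (inj₂ heavy) f-min g g-TR =
  heavy _ g (IsMinimumTR⇒IsGammaTRF G f-min) (Equivalence.from IsTRDF⇔TotalRoman g-TR)

proposition7p3 : (G : Graph) → NoIsolated G → (u v : Fin (n G)) → Adj (adj G) u v →
    Supercritical G u v →
    ∃[ f ] (IsGammaTRF G f × GoodPair (toℕ (f u)) (toℕ (f v)))
proposition7p3 G no-isolated u v uv supercritical =
  let f , f-min = IsMinimumTR-exists G no-isolated
      heavy = supercritical-heavy G uv supercritical f-min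
      g , g-min , good = minimum-with-GoodPair G (removeEdge-deletes G u v) uv f-min heavy
  in g , IsMinimumTR⇒IsGammaTRF G g-min , good
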